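{- Let $G_1$ be a graph of order $m_1$ having no pair of false twins, and let $G_2$ be the star graph $K_{1,m_2}$ of order $m_2+1$. Then $\mathrm{fix}(G_1*G_2)=m_1(m_2-1)+\mathrm{fix}(G_1)$.
   Context: All graphs are finite and simple. For graphs $G_1,G_2$, the co-normal product $G_1*G_2$ is the graph with vertex set $V(G_1)\times V(G_2)$ in which $(a,b)$ and $(c,d)$ are adjacent if and only if $a$ is adjacent to $c$ in $G_1$ or $b$ is adjacent to $d$ in $G_2$. Two distinct vertices $u,v$ are false twins if $N(u)=N(v)$ (open neighborhoods). A set $F\subseteq V(G)$ is a fixing set of $G$ if the only automorphism of $G$ fixing every vertex of $F$ is the identity; $\mathrm{fix}(G)$ is the minimum cardinality of a fixing set. -}

module Defs where

open import Data.Nat using (ℕ; zero; suc; _≤_)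
open import Data.Fin using (Fin; zero)
open import Data.Product using (_×_; _,_; Σ; ∃; ∃-syntax; proj₁; proj₂)
open import Data.Sum using (_⊎_; inj₁; inj₂)
open import Data.Empty using (⊥)
open import Data.List using (List; length)
open import Data.List.Membership.Propositional using (_∈_)
open import Data.List.Relation.Unary.Unique.Propositional using (Unique)
open import Function using (_⇔_; Equivalence)
open import Function.Bundles using (_⤖_; Bijection)
open import Relation.Nullary using (¬_)
open import Relation.Binary.PropositionalEquality using (_≡_; _≢_; refl)

record Graph (V : Set) : Set₁ where
  field
    Adj    : V → V → Set
    adj-sym : ∀ {x y} → Adj x y → Adj y x
    irrefl : ∀ {x} → ¬ Adj x x
open Graph public

record Automorphism {V : Set} (G : Graph V) : Set where
  field
    perm : V ⤖ V
    preserves : ∀ x y → Adj G x y ⇔ Adj G (Bijection.to perm x) (Bijection.to perm y)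
open Automorphism public

app : ∀ {V} {G : Graph V} → Automorphism G → V → V
app σ = Bijection.to (perm σ)

IsFixingSet : ∀ {V} (G : Graph V) → List V → Set
IsFixingSet G F = (σ : Automorphism G) → (∀ v → v ∈ F → app σ v ≡ v) → ∀ v → app σ v ≡ v

-- fix(G) = k : k is the minimum cardinality of a fixing set
-- (sets are represented by duplicate-free lists; cardinality = length).
FixNumber : ∀ {V} (G : Graph V) → ℕ → Set
FixNumber G k =
  (Σ (List _) λ F → Unique F × IsFixingSet G F × length F ≡ k)
  × (∀ F → Unique F → IsFixingSet G F → k ≤ length F)

NoFalseTwins : ∀ {V} (G : Graph V) → Set
NoFalseTwins {V} G = ∀ (u v : V) → (∀ w → Adj G u w ⇔ Adj G v w) → u ≡ v

_⊛_ : ∀ {V W} → Graph V → Graph W → Graph (V × W)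
G ⊛ H = record
  { Adj = λ { (a , b) (c , d) → Adj G a c ⊎ Adj H b d }
  ; adj-sym = λ { (inj₁ p) → inj₁ (Graph.adj-sym G p) ; (inj₂ q) → inj₂ (Graph.adj-sym H q) }
  ; irrefl = λ { (inj₁ p) → irrefl G p ; (inj₂ q) → irrefl H q }
  }

StarAdj : ∀ {m} → Fin (suc m) → Fin (suc m) → Set
StarAdj x y = (x ≡ zero × y ≢ zero) ⊎ (y ≡ zero × x ≢ zero)

star : (m : ℕ) → Graph (Fin (suc m))
star m = record
  { Adj = StarAdj
  ; adj-sym = λ { (inj₁ (p , q)) → inj₂ (p , q) ; (inj₂ (p , q)) → inj₁ (p , q) }
  ; irrefl = λ { (inj₁ (p , q)) → q p ; (inj₂ (p , q)) → q p }
  }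

module Submission where

-- 1. Counting lemmas on duplicate-free lists.
-- 2. General graph facts: automorphisms preserve false twins, the
--    transposition of two false twins is an automorphism, hence every
--    fixing set contains one of any two distinct false twins.
-- 3. Structure of G: leaves over the same a are false twins; when G₁ has
--    no false twins these are all the twins of a leaf.  Automorphisms of
--    G₁ lift to G, and automorphisms of G fixing all leaves restrict to G₁.
-- 4. Lower bound: a fixing set of G misses at most one leaf over each a
--    and its centre part is a fixing set of G₁ (by lifting).
-- 5. Upper bound: all leaves but the first over each a, plus the centres
--    of a minimum fixing set of G₁, form a fixing set: the first leaves
--    are then forced (twins of fixed leaves), and the rest restricts to G₁.

open import Defs
open import Data.Nat using (ℕ; zero; suc; _≤_; _+_; _*_; _∸_; z≤n; s≤s)
open import Data.Nat.Properties using (≤-reflexive; +-mono-≤; ∸-monoˡ-≤; module ≤-Reasoning)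
open import Data.Fin using (Fin; zero; suc; _≟_)
open import Data.Fin.Properties using (suc-injective)
open import Data.Product using (_×_; _,_; ∃; proj₁; proj₂)
open import Data.Product.Properties using (≡-dec; ,-injectiveˡ; ,-injectiveʳ)
open import Data.Sum using (inj₁; inj₂; [_,_])
import Data.Sum as Sum
open import Data.Empty using (⊥-elim)
open import Data.List using (List; []; _∷_; length; map; filter; _++_; allFin; cartesianProduct)
open import Data.List.Properties using (length-++; length-map; length-tabulate; length-removeAt′; filter-all; filter-++)
open import Data.List.Relation.Unary.Any using (here; there; _─_)
import Data.List.Relation.Unary.All as All
open import Data.List.Membership.Propositional using (_∈_; _∉_)
open import Data.List.Relation.Binary.Subset.Propositional using (_⊆_)
open import Data.List.Relation.Unary.Unique.Propositional using (Unique; []; _∷_)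
open import Data.List.Relation.Unary.Unique.Propositional.Properties using (map⁺; filter⁺; allFin⁺; ++⁺; cartesianProduct⁺)
open import Data.List.Membership.Propositional.Properties using (∈-map⁺; ∈-map⁻; ∈-filter⁺; ∈-filter⁻; ∈-allFin; ∈-cartesianProduct⁺; ∈-cartesianProduct⁻; ∈-++⁺ˡ; ∈-++⁺ʳ; ∈-++⁻)
open import Data.List.Relation.Binary.Disjoint.Propositional using (Disjoint)
open import Function using (_⇔_; Equivalence; mk⇔; id; _∘_)
open import Function.Bundles using (Bijection; mk⤖)
open import Function.Construct.Composition using (_⇔-∘_)
open import Function.Construct.Symmetry using (⇔-sym)
open import Function.Construct.Identity using (⇔-id)
open import Relation.Nullary using (¬_; yes; no)
open import Relation.Nullary.Decidable using (decidable-stable)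
open import Level using (0ℓ)
open import Relation.Unary using (Pred; Decidable)
open import Relation.Binary using (DecidableEquality)
open import Relation.Binary.PropositionalEquality using (_≡_; _≢_; refl; sym; trans; cong; cong₂; subst; subst₂; module ≡-Reasoning)

module _ {A : Set} where

  ∈-─ : ∀ {x y} (ys : List A) (x∈ys : x ∈ ys) → y ∈ ys → y ≢ x → y ∈ (ys ─ x∈ys)
  ∈-─ (_ ∷ _)  (here refl) (here refl) y≢x = ⊥-elim (y≢x refl)
  ∈-─ (_ ∷ _)  (here _)    (there y∈ys) _  = y∈ys
  ∈-─ (_ ∷ _)  (there _)   (here y≡z) _    = here y≡z
  ∈-─ (_ ∷ ys) (there x∈ys) (there y∈ys) y≢x = there (∈-─ ys x∈ys y∈ys y≢x)

  unique-⊆⇒length≤ : ∀ {xs ys : List A} → Unique xs → xs ⊆ ys → length xs ≤ length ys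
  unique-⊆⇒length≤ [] _ = z≤n
  unique-⊆⇒length≤ {x ∷ xs} {ys} (x∉xs ∷ uxs) xs⊆ys =
    subst (suc (length xs) ≤_) (sym (length-removeAt′ ys _))
      (s≤s (unique-⊆⇒length≤ uxs xs⊆ys─x))
    where
      x∈ys : x ∈ ys
      x∈ys = xs⊆ys (here refl)
      xs⊆ys─x : xs ⊆ (ys ─ x∈ys)
      xs⊆ys─x y∈xs = ∈-─ ys x∈ys (xs⊆ys (there y∈xs)) (λ y≡x → All.lookup x∉xs y∈xs (sym y≡x))

  length≤1+filter : ∀ {P : Pred A 0ℓ} (P? : Decidable P) (xs : List A) → Unique xs →
    (∀ {x y} → x ∈ xs → y ∈ xs → ¬ P x → ¬ P y → x ≡ y) →
    length xs ≤ suc (length (filter P? xs))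
  length≤1+filter P? [] _ _ = z≤n
  length≤1+filter {P} P? (x ∷ xs) (x∉xs ∷ uxs) atMostOne with P? x
  ... | yes _  = s≤s (length≤1+filter P? xs uxs λ p q → atMostOne (there p) (there q))
  ... | no ¬px = s≤s (≤-reflexive (sym (cong length (filter-all P? (All.tabulate allP)))))
    where
      allP : ∀ {y} → y ∈ xs → P y
      allP {y} y∈xs = decidable-stable (P? y) λ ¬py →
        All.lookup x∉xs y∈xs (atMostOne (here refl) (there y∈xs) ¬px ¬py)

length-allFin : ∀ n → length (allFin n) ≡ n
length-allFin n = length-tabulate id

module _ {A B : Set} where

  length-cartesianProduct : (xs : List A) (ys : List B) →
    length (cartesianProduct xs ys) ≡ length xs * length ys
  length-cartesianProduct []       ys = refl
  length-cartesianProduct (x ∷ xs) ys = begin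
    length (map (x ,_) ys ++ cartesianProduct xs ys)
      ≡⟨ length-++ (map (x ,_) ys) ⟩
    length (map (x ,_) ys) + length (cartesianProduct xs ys)
      ≡⟨ cong₂ _+_ (length-map (x ,_) ys) (length-cartesianProduct xs ys) ⟩
    length ys + length xs * length ys
      ∎
    where open ≡-Reasoning

  length-filter-cartesianProduct : ∀ {P : Pred (A × B) 0ℓ} (P? : Decidable P) {c : ℕ}
    (xs : List A) (ys : List B) → (∀ x → c ≤ length (filter P? (map (x ,_) ys))) →
    length xs * c ≤ length (filter P? (cartesianProduct xs ys))
  length-filter-cartesianProduct P? []       ys fibre = z≤n
  length-filter-cartesianProduct P? {c} (x ∷ xs) ys fibre = begin
    c + length xs * c
      ≤⟨ +-mono-≤ (fibre x) (length-filter-cartesianProduct P? xs ys fibre) ⟩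
    length (filter P? (map (x ,_) ys)) + length (filter P? (cartesianProduct xs ys))
      ≡⟨ sym (length-++ (filter P? (map (x ,_) ys))) ⟩
    length (filter P? (map (x ,_) ys) ++ filter P? (cartesianProduct xs ys))
      ≡⟨ cong length (sym (filter-++ P? (map (x ,_) ys) (cartesianProduct xs ys))) ⟩
    length (filter P? (cartesianProduct (x ∷ xs) ys))
      ∎
    where open ≤-Reasoning

-- u and v have the same open neighbourhood.
FalseTwins : ∀ {V} (G : Graph V) → V → V → Set
FalseTwins G u v = ∀ w → Adj G u w ⇔ Adj G v w

module _ {V : Set} {G : Graph V} where

  automorphism-preserves-twins : (σ : Automorphism G) → ∀ {u v} →
    FalseTwins G u v → FalseTwins G (app σ u) (app σ v)
  automorphism-preserves-twins σ {u} {v} twins w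
    with z , refl ← Bijection.strictlySurjective (perm σ) w =
    preserves σ v z ⇔-∘ (twins z ⇔-∘ ⇔-sym (preserves σ u z))

module Transposition {V : Set} (_≟V_ : DecidableEquality V) (G : Graph V)
                     {u v : V} (twins : FalseTwins G u v) where

  swap : V → V
  swap x with x ≟V u | x ≟V v
  ... | yes _ | _     = v
  ... | no _  | yes _ = u
  ... | no _  | no _  = x

  swap-u : swap u ≡ v
  swap-u with u ≟V u
  ... | yes _   = refl
  ... | no u≢u = ⊥-elim (u≢u refl)

  swap-v : swap v ≡ u
  swap-v with v ≟V u | v ≟V v
  ... | yes v≡u | _       = v≡u
  ... | no _    | yes _   = refl
  ... | no _    | no v≢v = ⊥-elim (v≢v refl)

  swap-other : ∀ {x} → x ≢ u → x ≢ v → swap x ≡ x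
  swap-other {x} x≢u x≢v with x ≟V u | x ≟V v
  ... | yes x≡u | _       = ⊥-elim (x≢u x≡u)
  ... | no _    | yes x≡v = ⊥-elim (x≢v x≡v)
  ... | no _    | no _    = refl

  swap-involutive : ∀ x → swap (swap x) ≡ x
  swap-involutive x with x ≟V u | x ≟V v
  ... | yes refl | _        = swap-v
  ... | no _     | yes refl = swap-u
  ... | no x≢u   | no x≢v   = swap-other x≢u x≢v

  swap-twins : ∀ x → FalseTwins G x (swap x)
  swap-twins x with x ≟V u | x ≟V v
  ... | yes refl | _        = twins
  ... | no _     | yes refl = λ w → ⇔-sym (twins w)
  ... | no _     | no _     = λ w → ⇔-id _

  -- Adjacency is preserved since x ~ swap x and y ~ swap y are twin pairs.
  swap-adj : ∀ {x y} → Adj G x y → Adj G (swap x) (swap y)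
  swap-adj {x} {y} xy =
    adj-sym G (Equivalence.to (swap-twins y (swap x)) (adj-sym G (Equivalence.to (swap-twins x y) xy)))

  swap-automorphism : Automorphism G
  swap-automorphism = record
    { perm      = mk⤖ (swap-injective , λ y → swap y , λ { refl → swap-involutive y })
    ; preserves = λ x y → mk⇔ swap-adj λ sxy →
        subst₂ (Adj G) (swap-involutive x) (swap-involutive y) (swap-adj sxy)
    }
    where
      swap-injective : ∀ {x y} → swap x ≡ swap y → x ≡ y
      swap-injective {x} {y} sx≡sy =
        trans (sym (swap-involutive x)) (trans (cong swap sx≡sy) (swap-involutive y))

fixing-set-meets-twins : ∀ {V} {G : Graph V} → DecidableEquality V → ∀ {F u v} →
  IsFixingSet G F → FalseTwins G u v → u ∉ F → v ∉ F → u ≡ v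
fixing-set-meets-twins {G = G} _≟V_ {F} {u} {v} fixF twins u∉F v∉F =
  trans (sym (fixF swap-automorphism fixesF u)) swap-u
  where
    open Transposition _≟V_ G twins
    fixesF : ∀ x → x ∈ F → swap x ≡ x
    fixesF x x∈F = swap-other (λ { refl → u∉F x∈F }) (λ { refl → v∉F x∈F })

star-centre-leaf : ∀ {n} (i : Fin n) → StarAdj {n} zero (suc i)
star-centre-leaf i = inj₁ (refl , λ ())

star-leaf-centre : ∀ {n} (i : Fin n) → StarAdj {n} (suc i) zero
star-leaf-centre i = inj₂ (refl , λ ())

star-leaves-twins : ∀ {n} {i j : Fin n} {d} → StarAdj (suc i) d → StarAdj (suc j) d
star-leaves-twins (inj₁ (() , _))
star-leaves-twins (inj₂ (d≡0 , _)) = inj₂ (d≡0 , λ ())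

-- The graph G = G₁ * K₁,ₙ.  The vertex (a , zero) is the centre over a and
-- (a , suc i) is the i-th leaf over a.
module StarProduct {m : ℕ} (G₁ : Graph (Fin m)) (n : ℕ) where

  Vertex : Set
  Vertex = Fin m × Fin (suc n)

  G : Graph Vertex
  G = G₁ ⊛ star n

  _≟V_ : DecidableEquality Vertex
  _≟V_ = ≡-dec _≟_ _≟_

  centre-adj : ∀ {a b} → Adj G (a , zero) (b , zero) ⇔ Adj G₁ a b
  centre-adj = mk⇔ [ id , ⊥-elim ∘ irrefl (star n) ] inj₁

  leaf-adj : ∀ {a b i j} → Adj G (a , suc i) (b , suc j) ⇔ Adj G₁ a b
  leaf-adj = mk⇔ [ id , ⊥-elim ∘ irrefl (star n) ∘ star-leaves-twins ] inj₁

  centre-leaf-adj : ∀ {a b j} → Adj G (a , zero) (b , suc j)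
  centre-leaf-adj {j = j} = inj₂ (star-centre-leaf j)

  leaf-twins : ∀ a i j → FalseTwins G (a , suc i) (a , suc j)
  leaf-twins a i j w = mk⇔ (Sum.map₂ star-leaves-twins) (Sum.map₂ star-leaves-twins)

  twins-of-leaf : NoFalseTwins G₁ → ∀ {y a i} → FalseTwins G y (a , suc i) → ∃ λ j → y ≡ (a , suc j)
  twins-of-leaf _ {c , zero} {a} {i} twins =
    ⊥-elim (irrefl G (Equivalence.from (twins (c , zero)) (inj₂ (star-leaf-centre i))))
  twins-of-leaf noTwins {c , suc j} {a} {i} twins =
    j , cong (_, suc j) (noTwins c a λ x → leaf-adj ⇔-∘ (twins (x , suc i) ⇔-∘ ⇔-sym leaf-adj))

  module Lift (τ : Automorphism G₁) where

    lift : Vertex → Vertex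
    lift (a , zero)  = app τ a , zero
    lift (a , suc i) = a , suc i

    lift-injective : ∀ {x y} → lift x ≡ lift y → x ≡ y
    lift-injective {a , zero}  {b , zero}  e  =
      cong (_, zero) (Bijection.injective (perm τ) (,-injectiveˡ e))
    lift-injective {a , suc i} {b , suc j} e  = e
    lift-injective {a , zero}  {b , suc j} ()
    lift-injective {a , suc i} {b , zero}  ()

    lift-surjective : ∀ y → ∃ λ x → ∀ {z} → z ≡ x → lift z ≡ y
    lift-surjective (c , zero)  with a , refl ← Bijection.strictlySurjective (perm τ) c =
      (a , zero) , λ { refl → refl }
    lift-surjective (c , suc i) = (c , suc i) , λ { refl → refl }

    lift-adj : ∀ x y → Adj G x y ⇔ Adj G (lift x) (lift y)
    lift-adj (a , zero)  (b , zero)  = ⇔-sym centre-adj ⇔-∘ (preserves τ a b ⇔-∘ centre-adj)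
    lift-adj (a , zero)  (b , suc j) = mk⇔ (λ _ → centre-leaf-adj) (λ _ → centre-leaf-adj)
    lift-adj (a , suc i) (b , zero)  =
      mk⇔ (λ _ → adj-sym G centre-leaf-adj) (λ _ → adj-sym G centre-leaf-adj)
    lift-adj (a , suc i) (b , suc j) = ⇔-id _

    liftAut : Automorphism G
    liftAut = record { perm = mk⤖ (lift-injective , lift-surjective) ; preserves = lift-adj }

  module Restrict (ψ : Automorphism G)
                  (fixes-leaves : ∀ a i → app ψ (a , suc i) ≡ (a , suc i)) where

    ψ-injective : ∀ {x y} → app ψ x ≡ app ψ y → x ≡ y
    ψ-injective = Bijection.injective (perm ψ)

    centre-to-centre : ∀ a → ∃ λ c → app ψ (a , zero) ≡ (c , zero)
    centre-to-centre a with app ψ (a , zero) in ψa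
    ... | c , zero = c , refl
    ... | c , suc i with () ← ψ-injective (trans ψa (sym (fixes-leaves c i)))

    restriction : Fin m → Fin m
    restriction a = proj₁ (centre-to-centre a)

    restriction-spec : ∀ a → app ψ (a , zero) ≡ (restriction a , zero)
    restriction-spec a = proj₂ (centre-to-centre a)

    restriction-injective : ∀ {a b} → restriction a ≡ restriction b → a ≡ b
    restriction-injective {a} {b} e = ,-injectiveˡ (ψ-injective
      (trans (restriction-spec a) (trans (cong (_, zero) e) (sym (restriction-spec b)))))

    restriction-surjective : ∀ c → ∃ λ a → ∀ {z} → z ≡ a → restriction z ≡ c
    restriction-surjective c with Bijection.strictlySurjective (perm ψ) (c , zero)
    ... | (a , zero) , ψa≡c = a , λ { refl → ,-injectiveˡ (trans (sym (restriction-spec a)) ψa≡c) }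
    ... | (a , suc i) , ψa≡c with () ← trans (sym (fixes-leaves a i)) ψa≡c

    restriction-adj : ∀ a b → Adj G₁ a b ⇔ Adj G₁ (restriction a) (restriction b)
    restriction-adj a b = mk⇔
      (λ ab → Equivalence.to centre-adj (subst₂ (Adj G) (restriction-spec a) (restriction-spec b)
                (Equivalence.to (preserves ψ _ _) (Equivalence.from centre-adj ab))))
      (λ rab → Equivalence.to centre-adj (Equivalence.from (preserves ψ _ _)
                (subst₂ (Adj G) (sym (restriction-spec a)) (sym (restriction-spec b))
                  (Equivalence.from centre-adj rab))))

    restrictionAut : Automorphism G₁
    restrictionAut = record
      { perm = mk⤖ (restriction-injective , restriction-surjective) ; preserves = restriction-adj }

  leaves : List Vertex
  leaves = cartesianProduct (allFin m) (map suc (allFin n))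

  leaf≢centre : ∀ {x : Vertex} {ds : List (Fin n)} →
    x ∈ cartesianProduct (allFin m) (map suc ds) → proj₂ x ≢ zero
  leaf≢centre x∈ with ∈-map⁻ suc (proj₂ (∈-cartesianProduct⁻ (allFin m) _ x∈))
  ... | _ , _ , refl = λ ()

  leaves-centres-disjoint : ∀ (ds : List (Fin n)) (cs : List (Fin m)) →
    Disjoint (cartesianProduct (allFin m) (map suc ds)) (map (_, zero) cs)
  leaves-centres-disjoint ds cs (x∈leaves , x∈centres) with ∈-map⁻ (_, zero) x∈centres
  ... | _ , _ , refl = leaf≢centre x∈leaves refl

  module LowerBound (F : List Vertex) (fixF : IsFixingSet G F) where
    open import Data.List.Membership.DecPropositional _≟V_ using (_∈?_)

    inF? : Decidable (_∈ F)
    inF? x = x ∈? F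

    fibre : Fin m → List Vertex
    fibre a = map (a ,_) (map suc (allFin n))

    -- F misses at most one of the n leaves over a, as they are pairwise false twins.
    fibre-in-F : ∀ a → n ∸ 1 ≤ length (filter inF? (fibre a))
    fibre-in-F a = ∸-monoˡ-≤ 1 (subst (_≤ suc (length (filter inF? (fibre a)))) length-fibre
      (length≤1+filter inF? (fibre a) unique-fibre missing-equal))
      where
        length-fibre : length (fibre a) ≡ n
        length-fibre = trans (length-map (a ,_) (map suc (allFin n)))
          (trans (length-map suc (allFin n)) (length-allFin n))
        unique-fibre : Unique (fibre a)
        unique-fibre = map⁺ ,-injectiveʳ (map⁺ suc-injective (allFin⁺ n))
        leaf-of-fibre : ∀ {x} → x ∈ fibre a → ∃ λ i → x ≡ (a , suc i)
        leaf-of-fibre x∈ with ∈-map⁻ (a ,_) x∈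
        ... | d , d∈ , refl with ∈-map⁻ suc d∈
        ...   | i , _ , refl = i , refl
        missing-equal : ∀ {x y} → x ∈ fibre a → y ∈ fibre a → x ∉ F → y ∉ F → x ≡ y
        missing-equal x∈ y∈ with leaf-of-fibre x∈ | leaf-of-fibre y∈
        ... | i , refl | j , refl = fixing-set-meets-twins _≟V_ fixF (leaf-twins a i j)

    leaves-in-F : m * (n ∸ 1) ≤ length (filter inF? leaves)
    leaves-in-F = subst (λ l → l * (n ∸ 1) ≤ length (filter inF? leaves)) (length-allFin m)
      (length-filter-cartesianProduct inF? (allFin m) (map suc (allFin n)) fibre-in-F)

    -- The bases of the centres in F form a fixing set of G₁: an automorphism of
    -- G₁ fixing them lifts to an automorphism of G fixing F.
    centres-in-F : List (Fin m)
    centres-in-F = filter (λ a → (a , zero) ∈? F) (allFin m)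

    centres-fixing : IsFixingSet G₁ centres-in-F
    centres-fixing τ fixes a = ,-injectiveˡ (fixF liftAut lift-fixes-F (a , zero))
      where
        open Lift τ
        lift-fixes-F : ∀ x → x ∈ F → lift x ≡ x
        lift-fixes-F (b , zero)  b∈F = cong (_, zero) (fixes b (∈-filter⁺ _ (∈-allFin b) b∈F))
        lift-fixes-F (b , suc j) _   = refl

    trace : List Vertex
    trace = filter inF? leaves ++ map (_, zero) centres-in-F

    unique-trace : Unique trace
    unique-trace = ++⁺ (filter⁺ inF? (cartesianProduct⁺ (allFin⁺ m) (map⁺ suc-injective (allFin⁺ n))))
                       (map⁺ ,-injectiveˡ (filter⁺ _ (allFin⁺ m)))
                       λ (x∈l , x∈c) → leaves-centres-disjoint (allFin n) centres-in-F
                                         (proj₁ (∈-filter⁻ inF? {xs = leaves} x∈l) , x∈c)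

    trace⊆F : trace ⊆ F
    trace⊆F x∈ with ∈-++⁻ (filter inF? leaves) x∈
    ... | inj₁ x∈l = proj₂ (∈-filter⁻ inF? {xs = leaves} x∈l)
    ... | inj₂ x∈c with ∈-map⁻ (_, zero) x∈c
    ...   | _ , a∈ , refl = proj₂ (∈-filter⁻ (λ a → (a , zero) ∈? F) {xs = allFin m} a∈)

    length-trace : length trace ≡ length (filter inF? leaves) + length centres-in-F
    length-trace = trans (length-++ (filter inF? leaves))
      (cong (length (filter inF? leaves) +_) (length-map (_, zero) centres-in-F))

  -- Every fixing set of G (even one with repetitions) has at least
  -- m·(n-1) + fix(G₁) elements: its leaves and centres are counted separately.
  fix-lower : ∀ {k} → FixNumber G₁ k → ∀ F → IsFixingSet G F → m * (n ∸ 1) + k ≤ length F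
  fix-lower {k} (_ , minimal) F fixF = begin
    m * (n ∸ 1) + k                                    ≤⟨ +-mono-≤ leaves-in-F fix≤centres ⟩
    length (filter inF? leaves) + length centres-in-F  ≡⟨ sym length-trace ⟩
    length trace                                       ≤⟨ unique-⊆⇒length≤ unique-trace trace⊆F ⟩
    length F                                           ∎
    where
      open LowerBound F fixF
      open ≤-Reasoning
      fix≤centres : k ≤ length centres-in-F
      fix≤centres = minimal centres-in-F (filter⁺ _ (allFin⁺ m)) centres-fixing

-- For n = p + 2 and G₁ without false twins: all leaves except the first over
-- every base, together with the centres over a fixing set F₁ of G₁, fix G.
module UpperBound {m : ℕ} (G₁ : Graph (Fin m)) (p : ℕ) (noTwins : NoFalseTwins G₁) where
  open StarProduct G₁ (suc (suc p))

  -- Star indices of all leaves but the first one, suc zero.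
  laterLeaves : List (Fin (suc (suc (suc p))))
  laterLeaves = map suc (map suc (allFin (suc p)))

  canonical : List (Fin m) → List Vertex
  canonical F₁ = cartesianProduct (allFin m) laterLeaves ++ map (_, zero) F₁

  unique-canonical : ∀ {F₁} → Unique F₁ → Unique (canonical F₁)
  unique-canonical {F₁} uF₁ =
    ++⁺ (cartesianProduct⁺ (allFin⁺ m) (map⁺ suc-injective (map⁺ suc-injective (allFin⁺ (suc p)))))
        (map⁺ ,-injectiveˡ uF₁)
        (leaves-centres-disjoint (map suc (allFin (suc p))) F₁)

  length-canonical : ∀ F₁ → length (canonical F₁) ≡ m * suc p + length F₁
  length-canonical F₁ = begin
    length (canonical F₁)
      ≡⟨ length-++ (cartesianProduct (allFin m) laterLeaves) ⟩
    length (cartesianProduct (allFin m) laterLeaves) + length (map (_, zero) F₁)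
      ≡⟨ cong₂ _+_ (length-cartesianProduct (allFin m) laterLeaves) (length-map (_, zero) F₁) ⟩
    length (allFin m) * length laterLeaves + length F₁
      ≡⟨ cong₂ (λ a b → a * b + length F₁) (length-allFin m) length-laterLeaves ⟩
    m * suc p + length F₁
      ∎
    where
      open ≡-Reasoning
      length-laterLeaves : length laterLeaves ≡ suc p
      length-laterLeaves = trans (length-map suc (map suc (allFin (suc p))))
        (trans (length-map suc (allFin (suc p))) (length-allFin (suc p)))

  canonical-fixing : ∀ {F₁} → IsFixingSet G₁ F₁ → IsFixingSet G (canonical F₁)
  canonical-fixing {F₁} fixF₁ ψ fixes = fixes-all
    where
      fixes-later : ∀ a j → app ψ (a , suc (suc j)) ≡ (a , suc (suc j))
      fixes-later a j = fixes _
        (∈-++⁺ˡ (∈-cartesianProduct⁺ (∈-allFin a) (∈-map⁺ suc (∈-map⁺ suc (∈-allFin j)))))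

      -- The first leaf over a is a twin of the fixed leaf (a , 2), so its image
      -- is a leaf over a; by injectivity it is not one of the fixed later leaves.
      fixes-first : ∀ a → app ψ (a , suc zero) ≡ (a , suc zero)
      fixes-first a with twins-of-leaf noTwins (subst (FalseTwins G _) (fixes-later a zero)
                           (automorphism-preserves-twins ψ (leaf-twins a zero (suc zero))))
      ... | zero  , ψa₁ = ψa₁
      ... | suc j , ψa₁ with () ← Bijection.injective (perm ψ) (trans ψa₁ (sym (fixes-later a j)))

      fixes-leaves : ∀ a i → app ψ (a , suc i) ≡ (a , suc i)
      fixes-leaves a zero    = fixes-first a
      fixes-leaves a (suc j) = fixes-later a j

      open Restrict ψ fixes-leaves

      restriction-id : ∀ a → restriction a ≡ a
      restriction-id = fixF₁ restrictionAut λ a a∈F₁ →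
        ,-injectiveˡ (trans (sym (restriction-spec a)) (fixes _ (∈-++⁺ʳ _ (∈-map⁺ (_, zero) a∈F₁))))

      fixes-all : ∀ x → app ψ x ≡ x
      fixes-all (a , zero)  = trans (restriction-spec a) (cong (_, zero) (restriction-id a))
      fixes-all (a , suc i) = fixes-leaves a i

theorem3p15 : (m₁ m₂ : ℕ) (G₁ : Graph (Fin m₁)) → 2 ≤ m₂ → NoFalseTwins G₁ →
    (k : ℕ) → FixNumber G₁ k → FixNumber (G₁ ⊛ star m₂) (m₁ * (m₂ ∸ 1) + k)
theorem3p15 m₁ (suc (suc p)) G₁ (s≤s (s≤s _)) noTwins k fixG₁@((F₁ , uniqueF₁ , fixingF₁ , refl) , _) =
  (canonical F₁ , unique-canonical uniqueF₁ , canonical-fixing fixingF₁ , length-canonical F₁) ,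
  λ F _ fixingF → fix-lower fixG₁ F fixingF
  where
    open StarProduct G₁ (suc (suc p)) using (fix-lower)
    open UpperBound G₁ p noTwins
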